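{- For all formulas with placeholder $\varphi_1,\varphi_2$ and all formulas $\psi_1,\psi_2$: $$\varphi_1\,\mathbf W\,\varphi_2[\psi_1\mathbf U\psi_2]\equiv\big(\varphi_1\,\mathbf U\,\varphi_2[\psi_1\mathbf U\psi_2]\big)\vee\mathbf G\varphi_1,$$ $$\varphi_1[\psi_1\mathbf U\psi_2]\,\mathbf W\,\varphi_2\equiv\big(\mathbf{GF}\psi_2\wedge\varphi_1[\psi_1\mathbf W\psi_2]\,\mathbf W\,\varphi_2\big)\vee\varphi_1[\psi_1\mathbf U\psi_2]\,\mathbf U\,\big(\varphi_2\vee\mathbf G(\varphi_1[\mathbf{ff}])\big).$$ (Here substitution binds more strongly than any operator, e.g. $\varphi_1\mathbf W\varphi_2[\psi]=\varphi_1\mathbf W(\varphi_2[\psi])$.)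
   Context: Formulas are in negation normal form over $\mathbf{tt},\mathbf{ff},a,\overline a,\wedge,\vee,\mathbf X,\mathbf U,\mathbf W$ and the unary operators $\mathbf{GF},\mathbf{FG}$, interpreted on infinite words over $2^{Ap}$ ($w_i$ suffix from $i$; $\varphi\mathbf U\psi$: $\exists k.\,w_k\models\psi\wedge\forall j<k.\,w_j\models\varphi$; $\varphi\mathbf W\psi$: $\forall k.\,w_k\models\varphi$ or $\varphi\mathbf U\psi$; $\mathbf{GF}\varphi$: $w_i\models\varphi$ for infinitely many $i$; $\mathbf{FG}\varphi$: for all but finitely many $i$); $\mathbf G\varphi:=\varphi\mathbf W\mathbf{ff}$. A formula with placeholder is a formula containing one or more (necessarily positive) occurrences of a special atomic proposition $[\ ]$; $\varphi[\psi]$ is the result of substituting $\psi$ for every occurrence of $[\ ]$ in $\varphi$. $\equiv$ denotes equality of sets of models. -}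

module Defs where

open import Data.Nat using (ℕ; _+_; _≤_; _<_)
open import Data.Bool using (Bool; true; false)
open import Data.Maybe using (Maybe; just; nothing)
open import Data.Product using (Σ; _×_; ∃-syntax)
open import Data.Sum using (_⊎_)
open import Data.Unit using (⊤)
open import Data.Empty using (⊥)
open import Relation.Binary.PropositionalEquality using (_≡_)
open import Relation.Nullary using (¬_)
open import Function.Bundles using (_⇔_)

-- LTL formulas in negation normal form over atomic propositions Ap,
-- with an extra special atomic proposition `hole` (the placeholder [ ]).
-- `hole` occurs only positively (there is no negated hole constructor).
data Formula (Ap : Set) : Set where
  tt ff : Formula Ap
  atom  : Ap → Formula Ap
  natom : Ap → Formula Ap
  hole  : Formula Ap
  _∧_ _∨_ _U_ _W_ : Formula Ap → Formula Ap → Formula Ap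
  X GF FG : Formula Ap → Formula Ap

infixr 6 _∧_
infixr 5 _∨_
infixr 7 _U_ _W_

G : ∀ {Ap} → Formula Ap → Formula Ap
G φ = φ W ff

_[_] : ∀ {Ap} → Formula Ap → Formula Ap → Formula Ap
tt [ ψ ] = tt
ff [ ψ ] = ff
atom a [ ψ ] = atom a
natom a [ ψ ] = natom a
hole [ ψ ] = ψ
(φ ∧ χ) [ ψ ] = (φ [ ψ ]) ∧ (χ [ ψ ])
(φ ∨ χ) [ ψ ] = (φ [ ψ ]) ∨ (χ [ ψ ])
(φ U χ) [ ψ ] = (φ [ ψ ]) U (χ [ ψ ])
(φ W χ) [ ψ ] = (φ [ ψ ]) W (χ [ ψ ])
X φ [ ψ ] = X (φ [ ψ ])
GF φ [ ψ ] = GF (φ [ ψ ])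
FG φ [ ψ ] = FG (φ [ ψ ])

data HasHole {Ap : Set} : Formula Ap → Set where
  here  : HasHole hole
  ∧ˡ    : ∀ {φ χ} → HasHole φ → HasHole (φ ∧ χ)
  ∧ʳ    : ∀ {φ χ} → HasHole χ → HasHole (φ ∧ χ)
  ∨ˡ    : ∀ {φ χ} → HasHole φ → HasHole (φ ∨ χ)
  ∨ʳ    : ∀ {φ χ} → HasHole χ → HasHole (φ ∨ χ)
  Uˡ    : ∀ {φ χ} → HasHole φ → HasHole (φ U χ)
  Uʳ    : ∀ {φ χ} → HasHole χ → HasHole (φ U χ)
  Wˡ    : ∀ {φ χ} → HasHole φ → HasHole (φ W χ)
  Wʳ    : ∀ {φ χ} → HasHole χ → HasHole (φ W χ)
  Xh    : ∀ {φ} → HasHole φ → HasHole (X φ)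
  GFh   : ∀ {φ} → HasHole φ → HasHole (GF φ)
  FGh   : ∀ {φ} → HasHole φ → HasHole (FG φ)

NoHole : ∀ {Ap} → Formula Ap → Set
NoHole φ = ¬ HasHole φ

-- Infinite words over 2^(Ap ∪ {[ ]}); a letter is the characteristic
-- function of a set of atomic propositions (nothing = the placeholder).
Word : Set → Set
Word Ap = ℕ → (Maybe Ap → Bool)

suffix : ∀ {Ap} → Word Ap → ℕ → Word Ap
suffix w i n = w (i + n)

infix 4 _⊨_
_⊨_ : ∀ {Ap} → Word Ap → Formula Ap → Set
w ⊨ tt = ⊤
w ⊨ ff = ⊥
w ⊨ atom a = w 0 (just a) ≡ true
w ⊨ natom a = w 0 (just a) ≡ false
w ⊨ hole = w 0 nothing ≡ true
w ⊨ (φ ∧ ψ) = (w ⊨ φ) × (w ⊨ ψ)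
w ⊨ (φ ∨ ψ) = (w ⊨ φ) ⊎ (w ⊨ ψ)
w ⊨ X φ = suffix w 1 ⊨ φ
w ⊨ (φ U ψ) = ∃[ k ] ((suffix w k ⊨ ψ) × (∀ j → j < k → suffix w j ⊨ φ))
w ⊨ (φ W ψ) = (∀ k → suffix w k ⊨ φ)
  ⊎ (∃[ k ] ((suffix w k ⊨ ψ) × (∀ j → j < k → suffix w j ⊨ φ)))
w ⊨ GF φ = ∀ n → ∃[ i ] ((n ≤ i) × (suffix w i ⊨ φ))
w ⊨ FG φ = ∃[ n ] (∀ i → n ≤ i → suffix w i ⊨ φ)

infix 3 _≣_
_≣_ : ∀ {Ap} → Formula Ap → Formula Ap → Set
φ ≣ ψ = ∀ w → (w ⊨ φ) ⇔ (w ⊨ ψ)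

-- The first equivalence is the unfolding φ W χ ≡ (φ U χ) ∨ G φ,
-- which holds for all formulas. For the second, split on whether ψ₂ holds
-- infinitely often. If it does, ψ₁ W ψ₂ and ψ₁ U ψ₂ agree at every position,
-- so they may be exchanged inside φ₁ (substitution is monotone because the
-- placeholder only occurs positively). If it does not, ψ₂ and hence ψ₁ U ψ₂
-- are false from some position n on, so G (φ₁ [ ψ₁ U ψ₂ ]) yields
-- G (φ₁ [ ff ]) at n, witnessing the until on the right.
module Submission where

open import Defs
open import Data.Nat using (ℕ; _+_; _<_; _<?_)
open import Data.Nat.Properties using (+-assoc; m≤m+n; ≮⇒≥; m≤n⇒∃[o]m+o≡n)
open import Data.Product using (_×_; _,_; ∃-syntax)
open import Data.Sum using (inj₁; inj₂)
open import Data.Maybe using (just; nothing)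
open import Level using (0ℓ)
open import Axiom.ExcludedMiddle using (ExcludedMiddle)
open import Axiom.DoubleNegationElimination using (em⇒dne)
open import Relation.Nullary using (¬_; yes; no)
open import Relation.Binary.PropositionalEquality
  using (_≗_; sym; trans; cong; subst)
open import Function.Bundles using (mk⇔)

private
  variable
    Ap : Set

suffix-resp-≗ : {v v′ : Word Ap} → v ≗ v′ → ∀ k → suffix v k ≗ suffix v′ k
suffix-resp-≗ e k n = e (k + n)

suffix-suffix : (w : Word Ap) (k j : ℕ) → suffix (suffix w k) j ≗ suffix w (k + j)
suffix-suffix w k j n = cong w (sym (+-assoc k j n))

⊨-resp-≗ : (φ : Formula Ap) {v v′ : Word Ap} → v ≗ v′ → v ⊨ φ → v′ ⊨ φ
⊨-resp-≗ tt e p = p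
⊨-resp-≗ ff e p = p
⊨-resp-≗ (atom a) e p = trans (cong (λ σ → σ (just a)) (sym (e 0))) p
⊨-resp-≗ (natom a) e p = trans (cong (λ σ → σ (just a)) (sym (e 0))) p
⊨-resp-≗ hole e p = trans (cong (λ σ → σ nothing) (sym (e 0))) p
⊨-resp-≗ (φ ∧ χ) e (p , q) = ⊨-resp-≗ φ e p , ⊨-resp-≗ χ e q
⊨-resp-≗ (φ ∨ χ) e (inj₁ p) = inj₁ (⊨-resp-≗ φ e p)
⊨-resp-≗ (φ ∨ χ) e (inj₂ q) = inj₂ (⊨-resp-≗ χ e q)
⊨-resp-≗ (X φ) e p = ⊨-resp-≗ φ (suffix-resp-≗ e 1) p
⊨-resp-≗ (φ U χ) e (k , p , before) =
  k , ⊨-resp-≗ χ (suffix-resp-≗ e k) p ,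
  λ j j<k → ⊨-resp-≗ φ (suffix-resp-≗ e j) (before j j<k)
⊨-resp-≗ (φ W χ) e (inj₁ always) =
  inj₁ λ k → ⊨-resp-≗ φ (suffix-resp-≗ e k) (always k)
⊨-resp-≗ (φ W χ) e (inj₂ until) = inj₂ (⊨-resp-≗ (φ U χ) e until)
⊨-resp-≗ (GF φ) e often n with often n
... | i , n≤i , p = i , n≤i , ⊨-resp-≗ φ (suffix-resp-≗ e i) p
⊨-resp-≗ (FG φ) e (n , later) =
  n , λ i n≤i → ⊨-resp-≗ φ (suffix-resp-≗ e i) (later i n≤i)

⊨-suffix-merge : (φ : Formula Ap) (w : Word Ap) (k j : ℕ) →
                 suffix (suffix w k) j ⊨ φ → suffix w (k + j) ⊨ φ
⊨-suffix-merge φ w k j = ⊨-resp-≗ φ (suffix-suffix w k j)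

⊨-suffix-split : (φ : Formula Ap) (w : Word Ap) (k j : ℕ) →
                 suffix w (k + j) ⊨ φ → suffix (suffix w k) j ⊨ φ
⊨-suffix-split φ w k j = ⊨-resp-≗ φ λ n → sym (suffix-suffix w k j n)

G-elim : (φ : Formula Ap) (w : Word Ap) → w ⊨ G φ → ∀ k → suffix w k ⊨ φ
G-elim φ w (inj₁ always) = always
G-elim φ w (inj₂ (_ , () , _))

always-from : (φ : Formula Ap) (w : Word Ap) (k : ℕ) →
              (∀ j → j < k → suffix w j ⊨ φ) → (∀ j → suffix (suffix w k) j ⊨ φ) →
              ∀ j → suffix w j ⊨ φ
always-from φ w k before after j with j <? k
... | yes j<k = before j j<k
... | no j≮k with m≤n⇒∃[o]m+o≡n (≮⇒≥ j≮k)
...   | o , k+o≡j = subst (λ i → suffix w i ⊨ φ) k+o≡j (⊨-suffix-merge φ w k o (after o))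

GF-suffix : (ψ : Formula Ap) (w : Word Ap) → w ⊨ GF ψ → ∀ k → suffix w k ⊨ GF ψ
GF-suffix ψ w often k n with often (k + n)
... | i , k+n≤i , p with m≤n⇒∃[o]m+o≡n k+n≤i
...   | o , k+n+o≡i =
  n + o , m≤m+n n o ,
  ⊨-suffix-split ψ w k (n + o)
    (subst (λ i → suffix w i ⊨ ψ) (trans (sym k+n+o≡i) (+-assoc k n o)) p)

record AlwaysImplies (w : Word Ap) (ψ ψ′ : Formula Ap) : Set where
  constructor always-implies
  field at : ∀ k → suffix w k ⊨ ψ → suffix w k ⊨ ψ′
open AlwaysImplies

AlwaysImplies-suffix : {w : Word Ap} {ψ ψ′ : Formula Ap} →
                       AlwaysImplies w ψ ψ′ → ∀ i → AlwaysImplies (suffix w i) ψ ψ′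
AlwaysImplies-suffix {w = w} {ψ} {ψ′} H i =
  always-implies λ k p → ⊨-suffix-split ψ′ w i k (H .at (i + k) (⊨-suffix-merge ψ w i k p))

[]-mono : (φ : Formula Ap) {ψ ψ′ : Formula Ap} (w : Word Ap) →
          AlwaysImplies w ψ ψ′ → w ⊨ φ [ ψ ] → w ⊨ φ [ ψ′ ]
[]-mono tt w H p = p
[]-mono ff w H p = p
[]-mono (atom a) w H p = p
[]-mono (natom a) w H p = p
[]-mono hole w H p = H .at 0 p
[]-mono (φ ∧ χ) w H (p , q) = []-mono φ w H p , []-mono χ w H q
[]-mono (φ ∨ χ) w H (inj₁ p) = inj₁ ([]-mono φ w H p)
[]-mono (φ ∨ χ) w H (inj₂ q) = inj₂ ([]-mono χ w H q)
[]-mono (X φ) w H p = []-mono φ (suffix w 1) (AlwaysImplies-suffix H 1) p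
[]-mono (φ U χ) w H (k , p , before) =
  k , []-mono χ (suffix w k) (AlwaysImplies-suffix H k) p ,
  λ j j<k → []-mono φ (suffix w j) (AlwaysImplies-suffix H j) (before j j<k)
[]-mono (φ W χ) w H (inj₁ always) =
  inj₁ λ k → []-mono φ (suffix w k) (AlwaysImplies-suffix H k) (always k)
[]-mono (φ W χ) w H (inj₂ until) = inj₂ ([]-mono (φ U χ) w H until)
[]-mono (GF φ) w H often n with often n
... | i , n≤i , p = i , n≤i , []-mono φ (suffix w i) (AlwaysImplies-suffix H i) p
[]-mono (FG φ) w H (n , later) =
  n , λ i n≤i → []-mono φ (suffix w i) (AlwaysImplies-suffix H i) (later i n≤i)

[]-mono-always : (φ : Formula Ap) {ψ ψ′ : Formula Ap} {w : Word Ap} →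
                 AlwaysImplies w ψ ψ′ → AlwaysImplies w (φ [ ψ ]) (φ [ ψ′ ])
[]-mono-always φ {w = w} H =
  always-implies λ k → []-mono φ (suffix w k) (AlwaysImplies-suffix H k)

W-monoˡ : {φ φ′ χ : Formula Ap} {w : Word Ap} →
          AlwaysImplies w φ φ′ → w ⊨ φ W χ → w ⊨ φ′ W χ
W-monoˡ H (inj₁ always) = inj₁ λ k → H .at k (always k)
W-monoˡ H (inj₂ (k , p , before)) = inj₂ (k , p , λ j j<k → H .at j (before j j<k))

W⇒U-if-GF : (ψ₁ ψ₂ : Formula Ap) (w : Word Ap) → w ⊨ GF ψ₂ → w ⊨ ψ₁ W ψ₂ → w ⊨ ψ₁ U ψ₂
W⇒U-if-GF ψ₁ ψ₂ w often (inj₂ until) = until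
W⇒U-if-GF ψ₁ ψ₂ w often (inj₁ always) with often 0
... | i , _ , p = i , p , λ j _ → always j

U⇒W-always : (ψ₁ ψ₂ : Formula Ap) (w : Word Ap) → AlwaysImplies w (ψ₁ U ψ₂) (ψ₁ W ψ₂)
U⇒W-always ψ₁ ψ₂ w = always-implies λ _ → inj₂

W⇒U-always-if-GF : (ψ₁ ψ₂ : Formula Ap) (w : Word Ap) →
                   w ⊨ GF ψ₂ → AlwaysImplies w (ψ₁ W ψ₂) (ψ₁ U ψ₂)
W⇒U-always-if-GF ψ₁ ψ₂ w often =
  always-implies λ k → W⇒U-if-GF ψ₁ ψ₂ (suffix w k) (GF-suffix ψ₂ w often k)

ff-always : (ψ : Formula Ap) (w : Word Ap) → AlwaysImplies w ff ψ
ff-always ψ w = always-implies λ _ ()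

U-never : (ψ₁ ψ₂ : Formula Ap) {v : Word Ap} →
          AlwaysImplies v ψ₂ ff → AlwaysImplies v (ψ₁ U ψ₂) ff
U-never ψ₁ ψ₂ {v} never =
  always-implies λ { k (m , p , _) → never .at (k + m) (⊨-suffix-merge ψ₂ v k m p) }

¬GF⇒eventually-never : ExcludedMiddle 0ℓ → (ψ : Formula Ap) (w : Word Ap) →
                       ¬ (w ⊨ GF ψ) → ∃[ n ] AlwaysImplies (suffix w n) ψ ff
¬GF⇒eventually-never em ψ w ¬often =
  dne λ ¬eventually → ¬often λ n → dne λ ¬occurs →
    ¬eventually (n , always-implies λ k p →
      ¬occurs (n + k , m≤m+n n k , ⊨-suffix-merge ψ w n k p))
  where dne = em⇒dne em

W≣U∨G : (φ χ : Formula Ap) → (φ W χ) ≣ ((φ U χ) ∨ G φ)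
W≣U∨G φ χ w = mk⇔ to from
  where
  to : w ⊨ φ W χ → w ⊨ (φ U χ) ∨ G φ
  to (inj₁ always) = inj₂ (inj₁ always)
  to (inj₂ until) = inj₁ until
  from : w ⊨ (φ U χ) ∨ G φ → w ⊨ φ W χ
  from (inj₁ until) = inj₂ until
  from (inj₂ g) = inj₁ (G-elim φ w g)

weakUntil-untilˡ : ExcludedMiddle 0ℓ → (φ₁ φ₂ ψ₁ ψ₂ : Formula Ap) →
  ((φ₁ [ ψ₁ U ψ₂ ]) W φ₂)
    ≣ ((GF ψ₂ ∧ ((φ₁ [ ψ₁ W ψ₂ ]) W φ₂))
       ∨ ((φ₁ [ ψ₁ U ψ₂ ]) U (φ₂ ∨ G (φ₁ [ ff ]))))
weakUntil-untilˡ em φ₁ φ₂ ψ₁ ψ₂ w = mk⇔ to from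
  where
  to : w ⊨ (φ₁ [ ψ₁ U ψ₂ ]) W φ₂ →
       w ⊨ (GF ψ₂ ∧ ((φ₁ [ ψ₁ W ψ₂ ]) W φ₂)) ∨ ((φ₁ [ ψ₁ U ψ₂ ]) U (φ₂ ∨ G (φ₁ [ ff ])))
  to (inj₂ (k , p , before)) = inj₂ (k , inj₁ p , before)
  to (inj₁ always) with em {w ⊨ GF ψ₂}
  ... | yes often =
    inj₁ (often , inj₁ λ k → []-mono-always φ₁ (U⇒W-always ψ₁ ψ₂ w) .at k (always k))
  ... | no ¬often with ¬GF⇒eventually-never em ψ₂ w ¬often
  ...   | n , never =
    inj₂ (n , inj₂ (inj₁ λ k →
      []-mono-always φ₁ (U-never ψ₁ ψ₂ never) .at k
        (⊨-suffix-split (φ₁ [ ψ₁ U ψ₂ ]) w n k (always (n + k))))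
      , λ j _ → always j)
  from : w ⊨ (GF ψ₂ ∧ ((φ₁ [ ψ₁ W ψ₂ ]) W φ₂)) ∨ ((φ₁ [ ψ₁ U ψ₂ ]) U (φ₂ ∨ G (φ₁ [ ff ]))) →
         w ⊨ (φ₁ [ ψ₁ U ψ₂ ]) W φ₂
  from (inj₁ (often , weak)) =
    W-monoˡ {χ = φ₂} ([]-mono-always φ₁ (W⇒U-always-if-GF ψ₁ ψ₂ w often)) weak
  from (inj₂ (k , inj₁ p , before)) = inj₂ (k , p , before)
  from (inj₂ (k , inj₂ g , before)) =
    inj₁ (always-from (φ₁ [ ψ₁ U ψ₂ ]) w k before
           λ j → []-mono-always φ₁ (ff-always (ψ₁ U ψ₂) (suffix w k)) .at j
             (G-elim (φ₁ [ ff ]) (suffix w k) g j))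

lemma5p6 : ExcludedMiddle 0ℓ →
    {Ap : Set} (φ₁ φ₂ : Formula Ap) → HasHole φ₁ → HasHole φ₂ →
    (ψ₁ ψ₂ : Formula Ap) → NoHole ψ₁ → NoHole ψ₂ →
    ((φ₁ W (φ₂ [ ψ₁ U ψ₂ ])) ≣ ((φ₁ U (φ₂ [ ψ₁ U ψ₂ ])) ∨ G φ₁))
    ×
    (((φ₁ [ ψ₁ U ψ₂ ]) W φ₂)
      ≣ ((GF ψ₂ ∧ ((φ₁ [ ψ₁ W ψ₂ ]) W φ₂))
         ∨ ((φ₁ [ ψ₁ U ψ₂ ]) U (φ₂ ∨ G (φ₁ [ ff ])))))
lemma5p6 em φ₁ φ₂ _ _ ψ₁ ψ₂ _ _ =
  W≣U∨G φ₁ (φ₂ [ ψ₁ U ψ₂ ]) , weakUntil-untilˡ em φ₁ φ₂ ψ₁ ψ₂
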